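{- The axiomatization consisting of A1-4, WIF1, WIF2$'$ and W1 is sound and ground-complete for BCCS($A$) modulo $\precsim_{\rm WIF}$.
   Context: $A$ is a nonempty countable set of actions, $\tau\notin A$, $A_\tau=A\cup\{\tau\}$. BCCS($A$) terms: $t::=0\mid x\mid\alpha t\mid t+t$ ($x$ a variable, $\alpha\in A_\tau$); closed terms contain no variables. Transitions: $\alpha t\xrightarrow{\alpha}t$; if $t\xrightarrow{\alpha}t'$ then $t+u\xrightarrow{\alpha}t'$ and $u+t\xrightarrow{\alpha}t'$. $\Rightarrow$ is the reflexive-transitive closure of $\xrightarrow{\tau}$. $a_1\cdots a_k\in A^*$ is a weak trace of $s$ if $s\Rightarrow\xrightarrow{a_1}\Rightarrow\cdots\xrightarrow{a_k}\Rightarrow s'$; $\mathcal{WT}(s)$ the set. $(a_1\cdots a_k,B)$, $B\subseteq A^*$, is a weak impossible future of $s$ if $s\Rightarrow\xrightarrow{a_1}\Rightarrow\cdots\xrightarrow{a_k}\Rightarrow s'$ with $\mathcal{WT}(s')\cap B=\emptyset$. $s_1\precsim_{\rm WIF}s_2$ iff weak impossible futures of $s_1$ are weak impossible futures of $s_2$, $\mathcal{WT}(s_1)=\mathcal{WT}(s_2)$, and $s_1\xrightarrow{\tau}$ implies $s_2\xrightarrow{\tau}$; on open terms via all closed substitutions. Inequational logic (reflexivity, transitivity, substitution instances, closure under contexts; equation abbreviates two inequations); sound; ground-complete (closed $p\precsim_{\rm WIF}q$ implies $p\preccurlyeq q$ derivable). Axioms ($\alpha\in A_\tau$): A1: $x+y\approx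 y+x$; A2: $(x+y)+z\approx x+(y+z)$; A3: $x+x\approx x$; A4: $x+0\approx x$; WIF1: $\alpha(\tau x+\tau y)\approx\alpha x+\alpha y$; WIF2$'$: $\tau(x+y)\preccurlyeq\tau x+y$; W1: $x\preccurlyeq\tau x$. -}

module Defs where

open import Data.Nat using (ℕ)
open import Data.Empty using (⊥; ⊥-elim)
open import Data.List using (List; []; _∷_)
open import Data.Product using (Σ; ∃; _×_; _,_)
open import Function.Definitions using (Injective)
open import Relation.Binary.PropositionalEquality using (_≡_)

-- "A is a nonempty countable set": an injection into ℕ and an inhabitant.
Countable : Set → Set
Countable A = Σ (A → ℕ) λ f → Injective _≡_ _≡_ f

module BCCS (A : Set) where

  data Act : Set where
    τ   : Act
    act : A → Act

  infixl 6 _⊕_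
  data Term (X : Set) : Set where
    𝟘   : Term X
    var : X → Term X
    pre : Act → Term X → Term X
    _⊕_ : Term X → Term X → Term X

  OTerm : Set
  OTerm = Term ℕ

  Closed : Set
  Closed = Term ⊥

  subst : {X Y : Set} → (X → Term Y) → Term X → Term Y
  subst σ 𝟘         = 𝟘
  subst σ (var v)   = σ v
  subst σ (pre α t) = pre α (subst σ t)
  subst σ (t ⊕ u)   = subst σ t ⊕ subst σ u

  embed : Closed → OTerm
  embed = subst (λ x → ⊥-elim x)

  data _─[_]→_ : Closed → Act → Closed → Set where
    pref : ∀ {α t} → pre α t ─[ α ]→ t
    sumL : ∀ {α t t' u} → t ─[ α ]→ t' → (t ⊕ u) ─[ α ]→ t'
    sumR : ∀ {α t t' u} → t ─[ α ]→ t' → (u ⊕ t) ─[ α ]→ t'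

  data _⇒_ : Closed → Closed → Set where
    ε   : ∀ {s} → s ⇒ s
    _◅_ : ∀ {s s₁ s'} → s ─[ τ ]→ s₁ → s₁ ⇒ s' → s ⇒ s'

  data _=[_]⇒_ : Closed → List A → Closed → Set where
    done : ∀ {s s'} → s ⇒ s' → s =[ [] ]⇒ s'
    step : ∀ {s s₁ s₂ s' a w} → s ⇒ s₁ → s₁ ─[ act a ]→ s₂ → s₂ =[ w ]⇒ s'
         → s =[ a ∷ w ]⇒ s'

  WT : Closed → List A → Set
  WT s w = ∃ λ s' → s =[ w ]⇒ s'

  WIF : Closed → List A → (List A → Set) → Set
  WIF s w B = ∃ λ s' → s =[ w ]⇒ s' × (∀ v → WT s' v → B v → ⊥)

  τ-enabled : Closed → Set
  τ-enabled s = ∃ λ s' → s ─[ τ ]→ s'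

  _≾WIF_ : Closed → Closed → Set₁
  s₁ ≾WIF s₂ =
      (∀ w B → WIF s₁ w B → WIF s₂ w B)
    × (∀ w → (WT s₁ w → WT s₂ w) × (WT s₂ w → WT s₁ w))
    × (τ-enabled s₁ → τ-enabled s₂)

  _≾WIFₒ_ : OTerm → OTerm → Set₁
  t ≾WIFₒ u = (ρ : ℕ → Closed) → subst ρ t ≾WIF subst ρ u

  -- the axioms, as inequations l ≼ r (an equation gives both directions)
  x y z : OTerm
  x = var 0
  y = var 1
  z = var 2

  data Axiom : OTerm → OTerm → Set where
    A1       : Axiom (x ⊕ y) (y ⊕ x)
    A2       : Axiom ((x ⊕ y) ⊕ z) (x ⊕ (y ⊕ z))
    A2⁻      : Axiom (x ⊕ (y ⊕ z)) ((x ⊕ y) ⊕ z)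
    A3       : Axiom (x ⊕ x) x
    A3⁻      : Axiom x (x ⊕ x)
    A4       : Axiom (x ⊕ 𝟘) x
    A4⁻      : Axiom x (x ⊕ 𝟘)
    WIF1     : ∀ α → Axiom (pre α (pre τ x ⊕ pre τ y)) (pre α x ⊕ pre α y)
    WIF1⁻    : ∀ α → Axiom (pre α x ⊕ pre α y) (pre α (pre τ x ⊕ pre τ y))
    WIF2'    : Axiom (pre τ (x ⊕ y)) (pre τ x ⊕ y)
    W1       : Axiom x (pre τ x)

  data _⊢≼_ : OTerm → OTerm → Set where
    ax     : ∀ {l r} (σ : ℕ → OTerm) → Axiom l r → subst σ l ⊢≼ subst σ r
    inst   : ∀ {t u} (σ : ℕ → OTerm) → t ⊢≼ u → subst σ t ⊢≼ subst σ u
    refl≼  : ∀ {t} → t ⊢≼ t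
    trans≼ : ∀ {t u v} → t ⊢≼ u → u ⊢≼ v → t ⊢≼ v
    ctxPre : ∀ {t u} α → t ⊢≼ u → pre α t ⊢≼ pre α u
    ctxSum : ∀ {t t' u u'} → t ⊢≼ t' → u ⊢≼ u' → (t ⊕ u) ⊢≼ (t' ⊕ u')

module Submission where

-- Runs: ≾WIF is characterised by matching of runs: p ≾WIF q iff q has the same
-- weak traces, can do τ when p can, and every run of p to e is matched by a run
-- of q with the same trace ending in a state with no more weak traces than e.
-- Soundness: with this characterisation each axiom instance is checked on closed
-- terms and ≾WIF is a precongruence; induction over derivations finishes.
-- Completeness: for closed p ≾WIF q we prove p ≼ p + q ≈ q + p ≼ q, using
--   * trace-summand: q ≼ q + r when the weak traces of r are among q's;
--   * summand-dropped: q + r ≼ q when moreover q matches the runs of r and can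
--     do τ when r can;
-- both by induction on r.  For a summand a.r the term q is compared with the
-- τ-choice Q among its finitely many weak a-derivatives: q ≈ q + a.Q, and every
-- weak run of q starting with a continues from Q.  Listing these derivatives
-- needs decidable equality on A, which countability provides.

open import Defs
open import Data.Nat using (ℕ)
open import Data.Nat.Properties using (eq?)
open import Data.Product using (_×_; ∃; _,_; proj₁; proj₂)
open import Data.Sum using (_⊎_; inj₁; inj₂)
open import Data.Empty using (⊥; ⊥-elim)
open import Data.List using (List; []; _∷_; _++_)
open import Data.List.Membership.Propositional using (_∈_)
open import Data.List.Membership.Propositional.Properties using (∈-++⁺ˡ; ∈-++⁺ʳ; ∈-++⁻)
open import Data.List.Relation.Unary.Any using (here; there)
open import Function.Bundles using (mk↣)
open import Relation.Nullary using (¬_; yes; no)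
open import Relation.Binary.Bundles using (Preorder)
open import Relation.Binary.Structures using (IsPreorder)
open import Relation.Binary.Definitions using (DecidableEquality)
open import Relation.Binary.PropositionalEquality using (_≡_; refl; sym; cong; cong₂) renaming (subst to ≡-subst)
import Relation.Binary.Reasoning.Preorder as PreorderReasoning

module Runs (A : Set) where
  open BCCS A

  infixr 5 _⋆_
  _⋆_ : Act → List A → List A
  τ     ⋆ w = w
  act a ⋆ w = a ∷ w

  ⇒-trans : ∀ {p q r} → p ⇒ q → q ⇒ r → p ⇒ r
  ⇒-trans ε         q⇒r = q⇒r
  ⇒-trans (t ◅ p⇒q) q⇒r = t ◅ ⇒-trans p⇒q q⇒r

  ⇒-run : ∀ {p q r w} → p ⇒ q → q =[ w ]⇒ r → p =[ w ]⇒ r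
  ⇒-run p⇒q (done q⇒r)       = done (⇒-trans p⇒q q⇒r)
  ⇒-run p⇒q (step q⇒ t run)  = step (⇒-trans p⇒q q⇒) t run

  step-run : ∀ {p α p₁ w r} → p ─[ α ]→ p₁ → p₁ =[ w ]⇒ r → p =[ α ⋆ w ]⇒ r
  step-run {α = τ}     t run = ⇒-run (t ◅ ε) run
  step-run {α = act a} t run = step ε t run

  data FirstStep (p : Closed) : List A → Closed → Set where
    stay  : FirstStep p [] p
    leave : ∀ {α p₁ w r} → p ─[ α ]→ p₁ → p₁ =[ w ]⇒ r → FirstStep p (α ⋆ w) r

  first-step : ∀ {p w r} → p =[ w ]⇒ r → FirstStep p w r
  first-step (done ε)                = stay
  first-step (done (t ◅ p⇒r))        = leave t (done p⇒r)
  first-step (step ε t run)          = leave t run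
  first-step (step (t ◅ p⇒) t′ run)  = leave t (step p⇒ t′ run)

  _⊆ᵀ_ : Closed → Closed → Set
  p ⊆ᵀ q = ∀ {w} → WT p w → WT q w

  WT-[] : ∀ {p} → WT p []
  WT-[] = _ , done ε

  WT-step : ∀ {p α p₁ w} → p ─[ α ]→ p₁ → WT p₁ w → WT p (α ⋆ w)
  WT-step t (_ , run) = _ , step-run t run

  _⟶⊆_ : Closed → Closed → Set
  p ⟶⊆ q = ∀ {α p₁} → p ─[ α ]→ p₁ → q ─[ α ]→ p₁

  WT-⟶⊆ : ∀ {p q} → p ⟶⊆ q → p ⊆ᵀ q
  WT-⟶⊆ p⟶⊆q (_ , run) with first-step run
  ... | stay         = WT-[]
  ... | leave t run′ = WT-step (p⟶⊆q t) (_ , run′)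

  WT-⊕⁻ : ∀ {p q w} → WT (p ⊕ q) w → WT p w ⊎ WT q w
  WT-⊕⁻ (_ , run) with first-step run
  ... | stay                = inj₁ WT-[]
  ... | leave (sumL t) run′ = inj₁ (WT-step t (_ , run′))
  ... | leave (sumR t) run′ = inj₂ (WT-step t (_ , run′))

  WT-τ⁻ : ∀ {p} → pre τ p ⊆ᵀ p
  WT-τ⁻ (_ , run) with first-step run
  ... | stay             = WT-[]
  ... | leave pref run′  = _ , run′

  WT-pre-mono : ∀ {α p q} → p ⊆ᵀ q → pre α p ⊆ᵀ pre α q
  WT-pre-mono p⊆q (_ , run) with first-step run
  ... | stay            = WT-[]
  ... | leave pref run′ = WT-step pref (p⊆q (_ , run′))

  -- Weak-trace inclusion up to double negation; this is the form in which
  -- impossible futures deliver it.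
  _⊑_ : Closed → Closed → Set
  p ⊑ q = ∀ v → WT p v → ¬ ¬ WT q v

  ⊑-refl : ∀ {p} → p ⊑ p
  ⊑-refl v h ¬h = ¬h h

  ⊆ᵀ⇒⊑ : ∀ {p q} → p ⊆ᵀ q → p ⊑ q
  ⊆ᵀ⇒⊑ p⊆q v h ¬h = ¬h (p⊆q h)

  ⊆ᵀ-⊑-trans : ∀ {p p′ q} → p′ ⊆ᵀ p → p ⊑ q → p′ ⊑ q
  ⊆ᵀ-⊑-trans p′⊆p p⊑q v h = p⊑q v (p′⊆p h)

  ⊑-⊆ᵀ-trans : ∀ {p q q′} → p ⊑ q → q ⊆ᵀ q′ → p ⊑ q′
  ⊑-⊆ᵀ-trans p⊑q q⊆q′ v h ¬h = p⊑q v h (λ h′ → ¬h (q⊆q′ h′))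

  Matched : Closed → List A → Closed → Set
  Matched q w e = ∃ λ q′ → q =[ w ]⇒ q′ × q′ ⊑ e

  Matches : Closed → Closed → Set
  Matches p q = ∀ {w e} → p =[ w ]⇒ e → Matched q w e

  Matched-τ : ∀ {q w e} → Matched q w e → Matched (pre τ q) w e
  Matched-τ (q′ , run , q′⊑e) = q′ , ⇒-run (pref ◅ ε) run , q′⊑e

  StepMatches : Closed → Closed → Set
  StepMatches p q = ∀ {α p₁ w e} → p ─[ α ]→ p₁ → p₁ =[ w ]⇒ e → Matched q (α ⋆ w) e

  -- A run of p to e yields the impossible future (w , ¬ WT e) of p; its
  -- counterpart in q is a match.
  ≾-matched : ∀ {p q w e} → p ≾WIF q → p =[ w ]⇒ e → Matched q w e
  ≾-matched {w = w} {e = e} (futures , _) run =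
    futures w (λ v → ¬ WT e v) (e , run , ⊑-refl)

  ≾-intro : ∀ {p q} → StepMatches p q → q ⊆ᵀ p
          → (τ-enabled p → τ-enabled q) → p ≾WIF q
  ≾-intro {p} {q} matches back τ-pres = futures , (λ w → forth , back) , τ-pres
    where
      futures : ∀ w B → WIF p w B → WIF q w B
      futures w B (e , run , avoids) with first-step run
      ... | stay = q , done ε , λ v h b → avoids v (back h) b
      ... | leave t run′ with matches t run′
      ...   | q′ , run-q , q′⊑e = q′ , run-q , λ v h b → q′⊑e v h (λ h′ → avoids v h′ b)
      forth : ∀ {w} → WT p w → WT q w
      forth (_ , run) with first-step run
      ... | stay         = WT-[]
      ... | leave t run′ = let q′ , run-q , _ = matches t run′ in q′ , run-q

  ⟶⊆-matches : ∀ {p q} → p ⟶⊆ q → StepMatches p q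
  ⟶⊆-matches p⟶⊆q t run = _ , step-run (p⟶⊆q t) run , ⊑-refl

  ≾-of-⟶⊆ : ∀ {p q} → p ⟶⊆ q → q ⟶⊆ p → p ≾WIF q
  ≾-of-⟶⊆ p⟶⊆q q⟶⊆p =
    ≾-intro (⟶⊆-matches p⟶⊆q) (WT-⟶⊆ q⟶⊆p) (λ (_ , t) → _ , p⟶⊆q t)

module Soundness (A : Set) where
  open BCCS A
  open Runs A

  ≾-refl : ∀ {p} → p ≾WIF p
  ≾-refl = (λ w B h → h) , (λ w → (λ h → h) , (λ h → h)) , (λ h → h)

  ≾-trans : ∀ {p q r} → p ≾WIF q → q ≾WIF r → p ≾WIF r
  ≾-trans (f₁ , t₁ , τ₁) (f₂ , t₂ , τ₂) =
      (λ w B h → f₂ w B (f₁ w B h))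
    , (λ w → (λ h → proj₁ (t₂ w) (proj₁ (t₁ w) h)) , (λ h → proj₂ (t₁ w) (proj₂ (t₂ w) h)))
    , (λ h → τ₂ (τ₁ h))

  -- A match by s is also one by a term s′ with more transitions; an empty
  -- match is rerouted through a τ-step of s, whose target has no more weak
  -- traces than s.
  Matched-lift : ∀ {s s′ w e} → s ⟶⊆ s′ → Matched s w e → (w ≡ [] → τ-enabled s)
               → Matched s′ w e
  Matched-lift s⟶⊆s′ (y , run , y⊑e) τ-en with first-step run
  ... | stay = let z , t = τ-en refl in
               z , step-run (s⟶⊆s′ t) (done ε) , ⊆ᵀ-⊑-trans (WT-step t) y⊑e
  ... | leave t run′ = y , step-run (s⟶⊆s′ t) run′ , y⊑e

  silent-τ-enabled : ∀ {α w s s₁ s′} → s ─[ α ]→ s₁ → (τ-enabled s → τ-enabled s′)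
                   → α ⋆ w ≡ [] → τ-enabled s′
  silent-τ-enabled {τ}     t τ-pres _  = τ-pres (_ , t)
  silent-τ-enabled {act a} t τ-pres ()

  ⊕-mono : ∀ {s₁ s₂ u₁ u₂} → s₁ ≾WIF s₂ → u₁ ≾WIF u₂ → (s₁ ⊕ u₁) ≾WIF (s₂ ⊕ u₂)
  ⊕-mono {s₁} {s₂} {u₁} {u₂} s≾@(_ , s-traces , s-τ) u≾@(_ , u-traces , u-τ) =
    ≾-intro matches back τ-pres
    where
      matches : StepMatches (s₁ ⊕ u₁) (s₂ ⊕ u₂)
      matches {w = w} (sumL t) run =
        Matched-lift sumL (≾-matched s≾ (step-run t run)) (silent-τ-enabled {w = w} t s-τ)
      matches {w = w} (sumR t) run =
        Matched-lift sumR (≾-matched u≾ (step-run t run)) (silent-τ-enabled {w = w} t u-τ)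
      back : (s₂ ⊕ u₂) ⊆ᵀ (s₁ ⊕ u₁)
      back {w} h with WT-⊕⁻ h
      ... | inj₁ h₁ = WT-⟶⊆ sumL (proj₂ (s-traces w) h₁)
      ... | inj₂ h₂ = WT-⟶⊆ sumR (proj₂ (u-traces w) h₂)
      τ-pres : τ-enabled (s₁ ⊕ u₁) → τ-enabled (s₂ ⊕ u₂)
      τ-pres (_ , sumL t) = let _ , t′ = s-τ (_ , t) in _ , sumL t′
      τ-pres (_ , sumR t) = let _ , t′ = u-τ (_ , t) in _ , sumR t′

  pre-mono : ∀ {α s₁ s₂} → s₁ ≾WIF s₂ → pre α s₁ ≾WIF pre α s₂
  pre-mono {α} {s₁} {s₂} s≾@(_ , traces , _) =
    ≾-intro matches (WT-pre-mono (proj₂ (traces _))) τ-pres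
    where
      matches : StepMatches (pre α s₁) (pre α s₂)
      matches pref run = let q′ , run′ , q′⊑e = ≾-matched s≾ run in q′ , step-run pref run′ , q′⊑e
      τ-pres : τ-enabled (pre α s₁) → τ-enabled (pre α s₂)
      τ-pres (_ , pref) = _ , pref

  -- A1-A4 (both directions) hold because both sides have the same transitions.
  ⊕-comm⟶ : ∀ {s u} → (s ⊕ u) ⟶⊆ (u ⊕ s)
  ⊕-comm⟶ (sumL t) = sumR t
  ⊕-comm⟶ (sumR t) = sumL t

  ⊕-assoc⟶ : ∀ {s u v} → ((s ⊕ u) ⊕ v) ⟶⊆ (s ⊕ (u ⊕ v))
  ⊕-assoc⟶ (sumL (sumL t)) = sumL t
  ⊕-assoc⟶ (sumL (sumR t)) = sumR (sumL t)
  ⊕-assoc⟶ (sumR t)        = sumR (sumR t)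

  ⊕-assoc⟵ : ∀ {s u v} → (s ⊕ (u ⊕ v)) ⟶⊆ ((s ⊕ u) ⊕ v)
  ⊕-assoc⟵ (sumL t)        = sumL (sumL t)
  ⊕-assoc⟵ (sumR (sumL t)) = sumL (sumR t)
  ⊕-assoc⟵ (sumR (sumR t)) = sumR t

  ⊕-idem⟶ : ∀ {s} → (s ⊕ s) ⟶⊆ s
  ⊕-idem⟶ (sumL t) = t
  ⊕-idem⟶ (sumR t) = t

  ⊕-unit⟶ : ∀ {s} → (s ⊕ 𝟘) ⟶⊆ s
  ⊕-unit⟶ (sumL t) = t
  ⊕-unit⟶ (sumR ())

  W1-sound : ∀ {s} → s ≾WIF pre τ s
  W1-sound = ≾-intro (λ t run → _ , step-run pref (step-run t run) , ⊑-refl)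
                     WT-τ⁻ (λ _ → _ , pref)

  WIF2-sound : ∀ {s u} → pre τ (s ⊕ u) ≾WIF (pre τ s ⊕ u)
  WIF2-sound {s} {u} = ≾-intro matches back (λ _ → _ , sumL pref)
    where
      matches : StepMatches (pre τ (s ⊕ u)) (pre τ s ⊕ u)
      matches pref run with first-step run
      ... | stay = s , step-run (sumL pref) (done ε) , ⊆ᵀ⇒⊑ (WT-⟶⊆ sumL)
      ... | leave (sumL t) run′ = _ , step-run (sumL pref) (step-run t run′) , ⊑-refl
      ... | leave (sumR t) run′ = _ , step-run (sumR t) run′ , ⊑-refl
      back : (pre τ s ⊕ u) ⊆ᵀ pre τ (s ⊕ u)
      back h with WT-⊕⁻ h
      ... | inj₁ h₁ = WT-step pref (WT-⟶⊆ sumL (WT-τ⁻ h₁))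
      ... | inj₂ h₂ = WT-step pref (WT-⟶⊆ sumR h₂)

  WIF1-sound : ∀ {α s u} → pre α (pre τ s ⊕ pre τ u) ≾WIF (pre α s ⊕ pre α u)
  WIF1-sound {α} {s} {u} = ≾-intro matches back τ-pres
    where
      matches : StepMatches (pre α (pre τ s ⊕ pre τ u)) (pre α s ⊕ pre α u)
      matches pref run with first-step run
      ... | stay = s , step-run (sumL pref) (done ε)
                 , ⊆ᵀ⇒⊑ (λ h → WT-⟶⊆ sumL (WT-step pref h))
      ... | leave (sumL pref) run′ = _ , step-run (sumL pref) run′ , ⊑-refl
      ... | leave (sumR pref) run′ = _ , step-run (sumR pref) run′ , ⊑-refl
      back : (pre α s ⊕ pre α u) ⊆ᵀ pre α (pre τ s ⊕ pre τ u)
      back h with WT-⊕⁻ h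
      ... | inj₁ h₁ = WT-pre-mono (λ h′ → WT-⟶⊆ sumL (WT-step pref h′)) h₁
      ... | inj₂ h₂ = WT-pre-mono (λ h′ → WT-⟶⊆ sumR (WT-step pref h′)) h₂
      τ-pres : τ-enabled (pre α (pre τ s ⊕ pre τ u)) → τ-enabled (pre α s ⊕ pre α u)
      τ-pres (_ , pref) = _ , sumL pref

  WIF1⁻-sound : ∀ {α s u} → (pre α s ⊕ pre α u) ≾WIF pre α (pre τ s ⊕ pre τ u)
  WIF1⁻-sound {α} {s} {u} = ≾-intro matches back τ-pres
    where
      matches : StepMatches (pre α s ⊕ pre α u) (pre α (pre τ s ⊕ pre τ u))
      matches (sumL pref) run = _ , step-run pref (step-run (sumL pref) run) , ⊑-refl
      matches (sumR pref) run = _ , step-run pref (step-run (sumR pref) run) , ⊑-refl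
      back : pre α (pre τ s ⊕ pre τ u) ⊆ᵀ (pre α s ⊕ pre α u)
      back (_ , run) with first-step run
      ... | stay = WT-[]
      ... | leave pref run′ with WT-⊕⁻ (_ , run′)
      ...   | inj₁ h₁ = WT-⟶⊆ sumL (WT-step pref (WT-τ⁻ h₁))
      ...   | inj₂ h₂ = WT-⟶⊆ sumR (WT-step pref (WT-τ⁻ h₂))
      τ-pres : τ-enabled (pre α s ⊕ pre α u) → τ-enabled (pre α (pre τ s ⊕ pre τ u))
      τ-pres (_ , sumL pref) = _ , pref
      τ-pres (_ , sumR pref) = _ , pref

  axiom-sound : ∀ {l r} → Axiom l r → (ρ : ℕ → Closed) → subst ρ l ≾WIF subst ρ r
  axiom-sound A1        ρ = ≾-of-⟶⊆ ⊕-comm⟶ ⊕-comm⟶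
  axiom-sound A2        ρ = ≾-of-⟶⊆ ⊕-assoc⟶ ⊕-assoc⟵
  axiom-sound A2⁻       ρ = ≾-of-⟶⊆ ⊕-assoc⟵ ⊕-assoc⟶
  axiom-sound A3        ρ = ≾-of-⟶⊆ ⊕-idem⟶ sumL
  axiom-sound A3⁻       ρ = ≾-of-⟶⊆ sumL ⊕-idem⟶
  axiom-sound A4        ρ = ≾-of-⟶⊆ ⊕-unit⟶ sumL
  axiom-sound A4⁻       ρ = ≾-of-⟶⊆ sumL ⊕-unit⟶
  axiom-sound (WIF1 α)  ρ = WIF1-sound
  axiom-sound (WIF1⁻ α) ρ = WIF1⁻-sound
  axiom-sound WIF2'     ρ = WIF2-sound
  axiom-sound W1        ρ = W1-sound

  subst-subst : ∀ {X Y Z : Set} (ρ : Y → Term Z) (σ : X → Term Y) t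
              → subst ρ (subst σ t) ≡ subst (λ n → subst ρ (σ n)) t
  subst-subst ρ σ 𝟘         = refl
  subst-subst ρ σ (var v)   = refl
  subst-subst ρ σ (pre α t) = cong (pre α) (subst-subst ρ σ t)
  subst-subst ρ σ (t ⊕ u)   = cong₂ _⊕_ (subst-subst ρ σ t) (subst-subst ρ σ u)

  sound : ∀ {t u} → t ⊢≼ u → t ≾WIFₒ u
  sound (ax {l} {r} σ a)   ρ rewrite subst-subst ρ σ l | subst-subst ρ σ r = axiom-sound a _
  sound (inst {t} {u} σ d) ρ rewrite subst-subst ρ σ t | subst-subst ρ σ u = sound d _
  sound refl≼              ρ = ≾-refl
  sound (trans≼ d e)       ρ = ≾-trans (sound d ρ) (sound e ρ)
  sound (ctxPre α d)       ρ = pre-mono (sound d ρ)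
  sound (ctxSum d e)       ρ = ⊕-mono (sound d ρ) (sound e ρ)

module Laws (A : Set) where
  open BCCS A

  [_,_,_] : OTerm → OTerm → OTerm → ℕ → OTerm
  [ t , u , v ] 0 = t
  [ t , u , v ] 1 = u
  [ t , u , v ] _ = v

  infix 4 _⊢≈_
  _⊢≈_ : OTerm → OTerm → Set
  t ⊢≈ u = (t ⊢≼ u) × (u ⊢≼ t)

  ≈-refl : ∀ {t} → t ⊢≈ t
  ≈-refl = refl≼ , refl≼

  ≈-sym : ∀ {t u} → t ⊢≈ u → u ⊢≈ t
  ≈-sym (t≼u , u≼t) = u≼t , t≼u

  ⊢≼-isPreorder : IsPreorder _⊢≈_ _⊢≼_
  ⊢≼-isPreorder = record
    { isEquivalence = record
        { refl  = ≈-refl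
        ; sym   = ≈-sym
        ; trans = λ (t≼u , u≼t) (u≼v , v≼u) → trans≼ t≼u u≼v , trans≼ v≼u u≼t
        }
    ; reflexive = proj₁
    ; trans     = trans≼
    }

  ⊢≼-preorder : Preorder _ _ _
  ⊢≼-preorder = record { isPreorder = ⊢≼-isPreorder }

  open PreorderReasoning ⊢≼-preorder public

  ⊕-cong : ∀ {t t′ u u′} → t ⊢≈ t′ → u ⊢≈ u′ → t ⊕ u ⊢≈ t′ ⊕ u′
  ⊕-cong (t≼t′ , t′≼t) (u≼u′ , u′≼u) = ctxSum t≼t′ u≼u′ , ctxSum t′≼t u′≼u

  pre-cong : ∀ {t u} α → t ⊢≈ u → pre α t ⊢≈ pre α u
  pre-cong α (t≼u , u≼t) = ctxPre α t≼u , ctxPre α u≼t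

  comm : ∀ t u → t ⊕ u ⊢≈ u ⊕ t
  comm t u = ax [ t , u , 𝟘 ] A1 , ax [ u , t , 𝟘 ] A1

  assoc : ∀ t u v → (t ⊕ u) ⊕ v ⊢≈ t ⊕ (u ⊕ v)
  assoc t u v = ax [ t , u , v ] A2 , ax [ t , u , v ] A2⁻

  idem : ∀ t → t ⊕ t ⊢≈ t
  idem t = ax [ t , 𝟘 , 𝟘 ] A3 , ax [ t , 𝟘 , 𝟘 ] A3⁻

  unit : ∀ t → t ⊕ 𝟘 ⊢≈ t
  unit t = ax [ t , 𝟘 , 𝟘 ] A4 , ax [ t , 𝟘 , 𝟘 ] A4⁻

  wif1 : ∀ α t u → pre α (pre τ t ⊕ pre τ u) ⊢≈ pre α t ⊕ pre α u
  wif1 α t u = ax [ t , u , 𝟘 ] (WIF1 α) , ax [ t , u , 𝟘 ] (WIF1⁻ α)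

  wif2 : ∀ t u → pre τ (t ⊕ u) ⊢≼ (pre τ t ⊕ u)
  wif2 t u = ax [ t , u , 𝟘 ] WIF2'

  w1 : ∀ t → t ⊢≼ pre τ t
  w1 t = ax [ t , 𝟘 , 𝟘 ] W1

  -- A τ directly under a prefix is redundant (WIF1 with x = y).
  pre-τ : ∀ α t → pre α (pre τ t) ⊢≈ pre α t
  pre-τ α t = begin-equality
    pre α (pre τ t)               ≈⟨ pre-cong α (idem (pre τ t)) ⟨
    pre α (pre τ t ⊕ pre τ t)     ≈⟨ wif1 α t t ⟩
    pre α t ⊕ pre α t             ≈⟨ idem (pre α t) ⟩
    pre α t                       ∎

  τ-unfold : ∀ t → pre τ t ⊢≈ pre τ t ⊕ t
  τ-unfold t = (begin
      pre τ t          ≲⟨ ctxPre τ (proj₂ (idem t)) ⟩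
      pre τ (t ⊕ t)    ≲⟨ wif2 t t ⟩
      pre τ t ⊕ t      ∎)
    , (begin
      pre τ t ⊕ t          ≲⟨ ctxSum refl≼ (w1 t) ⟩
      pre τ t ⊕ pre τ t    ≈⟨ idem (pre τ t) ⟩
      pre τ t              ∎)

  τ-split : ∀ {u v} → u ⊢≼ (u ⊕ v) → pre τ u ⊢≼ (pre τ v ⊕ u)
  τ-split {u} {v} u≼u+v = begin
    pre τ u          ≲⟨ ctxPre τ u≼u+v ⟩
    pre τ (u ⊕ v)    ≈⟨ pre-cong τ (comm u v) ⟩
    pre τ (v ⊕ u)    ≲⟨ wif2 v u ⟩
    pre τ v ⊕ u      ∎

  τ-summand : ∀ {t u} → t ⊢≼ (t ⊕ u) → t ⊢≼ (t ⊕ pre τ u)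
  τ-summand {t} {u} t≼t+u = begin
    t              ≲⟨ w1 t ⟩
    pre τ t        ≲⟨ τ-split t≼t+u ⟩
    pre τ u ⊕ t    ≈⟨ comm (pre τ u) t ⟩
    t ⊕ pre τ u    ∎

  τ-widen : ∀ {u v} → u ⊢≼ (u ⊕ v) → pre τ u ⊢≼ (pre τ u ⊕ pre τ v)
  τ-widen {u} {v} u≼u+v = begin
    pre τ u              ≲⟨ ctxPre τ u≼u+v ⟩
    pre τ (u ⊕ v)        ≲⟨ wif2 u v ⟩
    pre τ u ⊕ v          ≲⟨ ctxSum refl≼ (w1 v) ⟩
    pre τ u ⊕ pre τ v    ∎

  _absorbs_ : OTerm → OTerm → Set
  t absorbs u = t ⊢≈ t ⊕ u

  absorbs-self : ∀ t → t absorbs t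
  absorbs-self t = ≈-sym (idem t)

  absorbs-⊕ˡ : ∀ {t u v} → t absorbs v → (t ⊕ u) absorbs v
  absorbs-⊕ˡ {t} {u} {v} t≈t+v = begin-equality
    t ⊕ u          ≈⟨ ⊕-cong t≈t+v ≈-refl ⟩
    t ⊕ v ⊕ u      ≈⟨ assoc t v u ⟩
    t ⊕ (v ⊕ u)    ≈⟨ ⊕-cong ≈-refl (comm v u) ⟩
    t ⊕ (u ⊕ v)    ≈⟨ assoc t u v ⟨
    t ⊕ u ⊕ v      ∎

  absorbs-⊕ʳ : ∀ {t u v} → u absorbs v → (t ⊕ u) absorbs v
  absorbs-⊕ʳ {t} {u} {v} u≈u+v = begin-equality
    t ⊕ u          ≈⟨ ⊕-cong ≈-refl u≈u+v ⟩
    t ⊕ (u ⊕ v)    ≈⟨ assoc t u v ⟨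
    t ⊕ u ⊕ v      ∎

  absorbs-⊕ : ∀ {t u v} → t absorbs u → t absorbs v → t absorbs (u ⊕ v)
  absorbs-⊕ {t} {u} {v} t≈t+u t≈t+v = begin-equality
    t              ≈⟨ t≈t+v ⟩
    t ⊕ v          ≈⟨ ⊕-cong t≈t+u ≈-refl ⟩
    t ⊕ u ⊕ v      ≈⟨ assoc t u v ⟩
    t ⊕ (u ⊕ v)    ∎

  absorbs-resp : ∀ {t u u′} → u ⊢≈ u′ → t absorbs u′ → t absorbs u
  absorbs-resp {t} {u} {u′} u≈u′ t≈t+u′ = begin-equality
    t        ≈⟨ t≈t+u′ ⟩
    t ⊕ u′   ≈⟨ ⊕-cong ≈-refl u≈u′ ⟨
    t ⊕ u    ∎

  absorbs-trans : ∀ {t u v} → t absorbs u → u absorbs v → t absorbs v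
  absorbs-trans {t} {u} {v} t≈t+u u≈u+v = begin-equality
    t              ≈⟨ t≈t+u ⟩
    t ⊕ u          ≈⟨ ⊕-cong ≈-refl u≈u+v ⟩
    t ⊕ (u ⊕ v)    ≈⟨ assoc t u v ⟨
    t ⊕ u ⊕ v      ≈⟨ ⊕-cong t≈t+u ≈-refl ⟨
    t ⊕ v          ∎

  -- Whatever u absorbs, τ.u absorbs too (since τ.u ≈ τ.u + u).
  τ-absorbs : ∀ {u v} → u absorbs v → pre τ u absorbs v
  τ-absorbs {u} {v} u≈u+v = begin-equality
    pre τ u              ≈⟨ τ-unfold u ⟩
    pre τ u ⊕ u          ≈⟨ ⊕-cong ≈-refl u≈u+v ⟩
    pre τ u ⊕ (u ⊕ v)    ≈⟨ assoc (pre τ u) u v ⟨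
    pre τ u ⊕ u ⊕ v      ≈⟨ ⊕-cong (τ-unfold u) ≈-refl ⟨
    pre τ u ⊕ v          ∎

  τ-self-absorbed : ∀ {t u} → t absorbs pre τ u → (t ⊕ pre τ t) ⊢≼ t
  τ-self-absorbed {t} {u} t≈t+τu = begin
    t ⊕ pre τ t                    ≈⟨ ⊕-cong ≈-refl (pre-cong τ t≈t+τu) ⟩
    t ⊕ pre τ (t ⊕ pre τ u)        ≈⟨ ⊕-cong ≈-refl (pre-cong τ (comm t (pre τ u))) ⟩
    t ⊕ pre τ (pre τ u ⊕ t)        ≲⟨ ctxSum refl≼ (wif2 (pre τ u) t) ⟩
    t ⊕ (pre τ (pre τ u) ⊕ t)      ≈⟨ ⊕-cong ≈-refl (⊕-cong (pre-τ τ u) ≈-refl) ⟩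
    t ⊕ (pre τ u ⊕ t)              ≈⟨ assoc t (pre τ u) t ⟨
    t ⊕ pre τ u ⊕ t                ≈⟨ ⊕-cong t≈t+τu ≈-refl ⟨
    t ⊕ t                          ≈⟨ idem t ⟩
    t                              ∎

module Completeness (A : Set) (_≟_ : DecidableEquality A) where
  open BCCS A
  open Runs A
  open Laws A

  ⌜_⌝ : Closed → OTerm
  ⌜_⌝ = embed

  step-absorbed : ∀ {p α s} → p ─[ α ]→ s → ⌜ p ⌝ absorbs pre α ⌜ s ⌝
  step-absorbed pref     = absorbs-self _
  step-absorbed (sumL t) = absorbs-⊕ˡ (step-absorbed t)
  step-absorbed (sumR t) = absorbs-⊕ʳ (step-absorbed t)

  τ-path-absorbed : ∀ {p p₁ p′} → p ─[ τ ]→ p₁ → p₁ ⇒ p′ → ⌜ p ⌝ absorbs pre τ ⌜ p′ ⌝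
  τ-path-absorbed t ε          = step-absorbed t
  τ-path-absorbed t (t′ ◅ p₁⇒) =
    absorbs-trans (step-absorbed t) (τ-absorbs (τ-path-absorbed t′ p₁⇒))

  τ-reduct-dropped : ∀ {p p′} → p ⇒ p′ → τ-enabled p → (⌜ p ⌝ ⊕ pre τ ⌜ p′ ⌝) ⊢≼ ⌜ p ⌝
  τ-reduct-dropped ε         (_ , t) = τ-self-absorbed (step-absorbed t)
  τ-reduct-dropped (t ◅ p₁⇒) _       = proj₂ (τ-path-absorbed t p₁⇒)

  derivatives : A → Closed → List Closed
  derivatives a 𝟘               = []
  derivatives a (var ())
  derivatives a (pre τ t)       = derivatives a t
  derivatives a (pre (act b) t) with a ≟ b
  ... | yes _ = t ∷ []
  ... | no _  = []
  derivatives a (t ⊕ u)         = derivatives a t ++ derivatives a u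

  derivatives-step : ∀ {a q s} → q ─[ act a ]→ s → s ∈ derivatives a q
  derivatives-step {a} pref with a ≟ a
  ... | yes _  = here refl
  ... | no a≢a = ⊥-elim (a≢a refl)
  derivatives-step (sumL t)                 = ∈-++⁺ˡ (derivatives-step t)
  derivatives-step {a} (sumR {u = u} t)     = ∈-++⁺ʳ (derivatives a u) (derivatives-step t)

  derivatives-τ : ∀ {a q q₁ s} → q ─[ τ ]→ q₁ → s ∈ derivatives a q₁ → s ∈ derivatives a q
  derivatives-τ pref                   s∈ = s∈
  derivatives-τ (sumL t)               s∈ = ∈-++⁺ˡ (derivatives-τ t s∈)
  derivatives-τ {a} (sumR {u = u} t)   s∈ = ∈-++⁺ʳ (derivatives a u) (derivatives-τ t s∈)

  derivatives-complete : ∀ {a q q₁ s} → q ⇒ q₁ → q₁ ─[ act a ]→ s → s ∈ derivatives a q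
  derivatives-complete ε        t = derivatives-step t
  derivatives-complete (t′ ◅ r) t = derivatives-τ t′ (derivatives-complete r t)

  derivatives-absorbed : ∀ {a} q {s} → s ∈ derivatives a q → ⌜ q ⌝ absorbs pre (act a) ⌜ s ⌝
  derivatives-absorbed 𝟘 ()
  derivatives-absorbed (var ())
  derivatives-absorbed (pre τ t) s∈ =
    absorbs-trans (step-absorbed {s = t} pref) (τ-absorbs (derivatives-absorbed t s∈))
  derivatives-absorbed {a} (pre (act b) t) s∈ with a ≟ b
  derivatives-absorbed (pre (act b) t) (here refl) | yes refl = step-absorbed {s = t} pref
  derivatives-absorbed (pre (act b) t) (there ())  | yes refl
  derivatives-absorbed (pre (act b) t) ()          | no _
  derivatives-absorbed {a} (t ⊕ u) s∈ with ∈-++⁻ (derivatives a t) s∈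
  ... | inj₁ s∈t = absorbs-⊕ˡ (derivatives-absorbed t s∈t)
  ... | inj₂ s∈u = absorbs-⊕ʳ (derivatives-absorbed u s∈u)

  choice : Closed → List Closed → Closed
  choice s []       = s
  choice s (d ∷ ds) = pre τ s ⊕ pre τ (choice d ds)

  choice-reaches : ∀ {s ds d} → d ∈ s ∷ ds → choice s ds ⇒ d
  choice-reaches {ds = []}    (here refl) = ε
  choice-reaches {ds = []}    (there ())
  choice-reaches {ds = _ ∷ _} (here refl) = sumL pref ◅ ε
  choice-reaches {ds = _ ∷ _} (there d∈)  = sumR pref ◅ choice-reaches d∈

  -- α.(choice) ≈ α.s₁ + ⋯ + α.sₙ by WIF1, so it is absorbed when every α.sᵢ is.
  choice-absorbed : ∀ {t α s ds} → (∀ {d} → d ∈ s ∷ ds → t absorbs pre α ⌜ d ⌝)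
                  → t absorbs pre α ⌜ choice s ds ⌝
  choice-absorbed {ds = []}     each = each (here refl)
  choice-absorbed {α = α} {s} {d ∷ ds} each =
    absorbs-resp (wif1 α ⌜ s ⌝ ⌜ choice d ds ⌝)
      (absorbs-⊕ (each (here refl)) (choice-absorbed (λ d∈ → each (there d∈))))

  record Derivative (a : A) (q : Closed) : Set where
    field
      Q         : Closed
      absorbed  : ⌜ q ⌝ absorbs pre (act a) ⌜ Q ⌝
      continues : ∀ {w q′} → q =[ a ∷ w ]⇒ q′ → Q =[ w ]⇒ q′

    traces-continue : ∀ {r} → pre (act a) r ⊑ q → r ⊑ Q
    traces-continue ar⊑q v h ¬h =
      ar⊑q (a ∷ v) (WT-step pref h) (λ (_ , run) → ¬h (_ , continues run))

    runs-continue : ∀ {r} → StepMatches (pre (act a) r) q → Matches r Q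
    runs-continue matches run =
      let q′ , run-q , q′⊑e = matches pref run in q′ , continues run-q , q′⊑e

  -- Such a Q exists as soon as q can (not not) perform a: take the τ-choice
  -- among the weak a-derivatives of q.
  derivative : ∀ a q → ¬ ¬ WT q (a ∷ []) → Derivative a q
  derivative a q can-a with derivatives a q in eq
  ... | [] = ⊥-elim (can-a λ { (_ , step r t _) →
                                  ∉[] (≡-subst (_ ∈_) eq (derivatives-complete r t)) })
    where
      ∉[] : ∀ {s : Closed} → s ∈ [] → ⊥
      ∉[] ()
  ... | s ∷ ds = record
    { Q         = choice s ds
    ; absorbed  = choice-absorbed λ {d} d∈ →
        derivatives-absorbed q {d} (≡-subst (_ ∈_) (sym eq) d∈)
    ; continues = λ { (step r t run) →
        ⇒-run (choice-reaches (≡-subst (_ ∈_) eq (derivatives-complete r t))) run }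
    }

  trace-summand : ∀ r q → r ⊑ q → ⌜ q ⌝ ⊢≼ (⌜ q ⌝ ⊕ ⌜ r ⌝)
  trace-summand 𝟘 q _ = proj₂ (unit ⌜ q ⌝)
  trace-summand (var ())
  trace-summand (r₁ ⊕ r₂) q r⊑q = begin
    ⌜ q ⌝                        ≲⟨ trace-summand r₁ q (⊆ᵀ-⊑-trans (WT-⟶⊆ sumL) r⊑q) ⟩
    ⌜ q ⌝ ⊕ ⌜ r₁ ⌝               ≲⟨ trace-summand r₂ (q ⊕ r₁) r₂⊑q+r₁ ⟩
    ⌜ q ⌝ ⊕ ⌜ r₁ ⌝ ⊕ ⌜ r₂ ⌝      ≈⟨ assoc ⌜ q ⌝ ⌜ r₁ ⌝ ⌜ r₂ ⌝ ⟩
    ⌜ q ⌝ ⊕ (⌜ r₁ ⌝ ⊕ ⌜ r₂ ⌝)    ∎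
    where
      r₂⊑q+r₁ : r₂ ⊑ (q ⊕ r₁)
      r₂⊑q+r₁ = ⊆ᵀ-⊑-trans (WT-⟶⊆ sumR) (⊑-⊆ᵀ-trans r⊑q (WT-⟶⊆ sumL))
  trace-summand (pre τ r) q r⊑q = τ-summand (trace-summand r q (⊆ᵀ-⊑-trans (WT-step pref) r⊑q))
  trace-summand (pre (act a) r) q ar⊑q = begin
    ⌜ q ⌝                                          ≈⟨ absorbed ⟩
    ⌜ q ⌝ ⊕ pre (act a) ⌜ Q ⌝                      ≈⟨ ⊕-cong ≈-refl (pre-τ (act a) ⌜ Q ⌝) ⟨
    ⌜ q ⌝ ⊕ pre (act a) (pre τ ⌜ Q ⌝)              ≲⟨ ctxSum refl≼ (ctxPre (act a) τQ≼τQ+τr) ⟩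
    ⌜ q ⌝ ⊕ pre (act a) (pre τ ⌜ Q ⌝ ⊕ pre τ ⌜ r ⌝) ≈⟨ ⊕-cong ≈-refl (wif1 (act a) ⌜ Q ⌝ ⌜ r ⌝) ⟩
    ⌜ q ⌝ ⊕ (pre (act a) ⌜ Q ⌝ ⊕ pre (act a) ⌜ r ⌝) ≈⟨ assoc _ _ _ ⟨
    ⌜ q ⌝ ⊕ pre (act a) ⌜ Q ⌝ ⊕ pre (act a) ⌜ r ⌝   ≈⟨ ⊕-cong absorbed ≈-refl ⟨
    ⌜ q ⌝ ⊕ pre (act a) ⌜ r ⌝                      ∎
    where
      open Derivative (derivative a q (ar⊑q (a ∷ []) (WT-step pref WT-[])))
      τQ≼τQ+τr : pre τ ⌜ Q ⌝ ⊢≼ (pre τ ⌜ Q ⌝ ⊕ pre τ ⌜ r ⌝)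
      τQ≼τQ+τr = τ-widen (trace-summand r Q (traces-continue ar⊑q))

  τ-summand-dropped : ∀ r q → r ⊑ q → Matches r q → τ-enabled q → (⌜ q ⌝ ⊕ pre τ ⌜ r ⌝) ⊢≼ ⌜ q ⌝

  summand-dropped : ∀ r q → r ⊑ q → StepMatches r q → (τ-enabled r → τ-enabled q)
                  → (⌜ q ⌝ ⊕ ⌜ r ⌝) ⊢≼ ⌜ q ⌝

  -- The empty run of r is matched by a silent run q ⇒ q′ with q′'s traces among r's.
  τ-summand-dropped r q r⊑q matches q-τ with matches (done ε)
  ... | q′ , done q⇒q′ , q′⊑r = begin
    ⌜ q ⌝ ⊕ pre τ ⌜ r ⌝                ≲⟨ ctxSum refl≼ (τ-split (trace-summand q′ r q′⊑r)) ⟩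
    ⌜ q ⌝ ⊕ (pre τ ⌜ q′ ⌝ ⊕ ⌜ r ⌝)     ≈⟨ assoc _ _ _ ⟨
    ⌜ q ⌝ ⊕ pre τ ⌜ q′ ⌝ ⊕ ⌜ r ⌝       ≲⟨ ctxSum (τ-reduct-dropped q⇒q′ q-τ) refl≼ ⟩
    ⌜ q ⌝ ⊕ ⌜ r ⌝                      ≲⟨ summand-dropped r q r⊑q step-matches (λ _ → q-τ) ⟩
    ⌜ q ⌝                              ∎
    where
      step-matches : StepMatches r q
      step-matches t run = matches (step-run t run)

  summand-dropped 𝟘 q _ _ _ = proj₁ (unit ⌜ q ⌝)
  summand-dropped (var ())
  summand-dropped (r₁ ⊕ r₂) q r⊑q matches τ-pres = begin
    ⌜ q ⌝ ⊕ (⌜ r₁ ⌝ ⊕ ⌜ r₂ ⌝)   ≈⟨ assoc _ _ _ ⟨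
    ⌜ q ⌝ ⊕ ⌜ r₁ ⌝ ⊕ ⌜ r₂ ⌝     ≲⟨ ctxSum drop-r₁ refl≼ ⟩
    ⌜ q ⌝ ⊕ ⌜ r₂ ⌝              ≲⟨ drop-r₂ ⟩
    ⌜ q ⌝                       ∎
    where
      drop-r₁ : (⌜ q ⌝ ⊕ ⌜ r₁ ⌝) ⊢≼ ⌜ q ⌝
      drop-r₁ = summand-dropped r₁ q (⊆ᵀ-⊑-trans (WT-⟶⊆ sumL) r⊑q)
                  (λ t → matches (sumL t)) (λ (_ , t) → τ-pres (_ , sumL t))
      drop-r₂ : (⌜ q ⌝ ⊕ ⌜ r₂ ⌝) ⊢≼ ⌜ q ⌝
      drop-r₂ = summand-dropped r₂ q (⊆ᵀ-⊑-trans (WT-⟶⊆ sumR) r⊑q)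
                  (λ t → matches (sumR t)) (λ (_ , t) → τ-pres (_ , sumR t))
  summand-dropped (pre τ r) q r⊑q matches τ-pres =
    τ-summand-dropped r q (⊆ᵀ-⊑-trans (WT-step pref) r⊑q) (matches pref) (τ-pres (_ , pref))
  summand-dropped (pre (act a) r) q ar⊑q matches _ = begin
    ⌜ q ⌝ ⊕ pre (act a) ⌜ r ⌝                      ≈⟨ ⊕-cong absorbed ≈-refl ⟩
    ⌜ q ⌝ ⊕ pre (act a) ⌜ Q ⌝ ⊕ pre (act a) ⌜ r ⌝   ≈⟨ assoc _ _ _ ⟩
    ⌜ q ⌝ ⊕ (pre (act a) ⌜ Q ⌝ ⊕ pre (act a) ⌜ r ⌝) ≈⟨ ⊕-cong ≈-refl (wif1 (act a) ⌜ Q ⌝ ⌜ r ⌝) ⟨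
    ⌜ q ⌝ ⊕ pre (act a) (pre τ ⌜ Q ⌝ ⊕ pre τ ⌜ r ⌝) ≲⟨ ctxSum refl≼ (ctxPre (act a) τQ+τr≼τQ) ⟩
    ⌜ q ⌝ ⊕ pre (act a) (pre τ ⌜ Q ⌝)              ≈⟨ ⊕-cong ≈-refl (pre-τ (act a) ⌜ Q ⌝) ⟩
    ⌜ q ⌝ ⊕ pre (act a) ⌜ Q ⌝                      ≈⟨ absorbed ⟨
    ⌜ q ⌝                                          ∎
    where
      open Derivative (derivative a q (ar⊑q (a ∷ []) (WT-step pref WT-[])))
      -- τ.Q rather than Q, which need not be able to do τ.
      τQ+τr≼τQ : (pre τ ⌜ Q ⌝ ⊕ pre τ ⌜ r ⌝) ⊢≼ pre τ ⌜ Q ⌝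
      τQ+τr≼τQ = τ-summand-dropped r (pre τ Q)
        (⊑-⊆ᵀ-trans (traces-continue ar⊑q) (WT-step pref))
        (λ run → Matched-τ (runs-continue matches run)) (_ , pref)

  complete : ∀ p q → p ≾WIF q → embed p ⊢≼ embed q
  complete p q p≾q@(_ , traces , τ-pres) = begin
    ⌜ p ⌝            ≲⟨ trace-summand q p (⊆ᵀ⇒⊑ (proj₂ (traces _))) ⟩
    ⌜ p ⌝ ⊕ ⌜ q ⌝    ≈⟨ comm ⌜ p ⌝ ⌜ q ⌝ ⟩
    ⌜ q ⌝ ⊕ ⌜ p ⌝    ≲⟨ summand-dropped p q (⊆ᵀ⇒⊑ (proj₁ (traces _)))
                         (λ t run → ≾-matched p≾q (step-run t run)) τ-pres ⟩
    ⌜ q ⌝            ∎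

corollary5p8 : (A : Set) → Countable A → A →
    let open BCCS A in
    (∀ (t u : OTerm) → t ⊢≼ u → t ≾WIFₒ u)
    × (∀ (p q : Closed) → p ≾WIF q → embed p ⊢≼ embed q)
-- Countability of A (an injection into ℕ) makes its equality decidable.
corollary5p8 A (f , f-injective) _ =
  (λ t u → Soundness.sound A) , Completeness.complete A (eq? (mk↣ f-injective))
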